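{- For each $\epsilon>0$ there exists $n_0$ such that the following holds. Let $n>n_0$, let $k\le n$ and $q\in(0,1)$ satisfy $q\ge\frac{k}{n}+\epsilon$, and let $\mathcal{F}\subseteq\binom{[n]}{k}$. Then \[\mu_q(f_{\mathcal{F}})\le\mu(\mathcal{F})\le\mu_q(f_{\mathcal{F}})(1+\epsilon).\]
   Context: Identify $x\in\{0,1\}^n$ with the set $\{i:x_i=1\}$ and write $|x|$ for its size. $\mu_q$ is the $q$-biased product measure on $\{0,1\}^n$, $\mu_q(f)=\mathbb{E}_{\mu_q}[f]$. $\mu(\mathcal{F})=|\mathcal{F}|/\binom nk$. For $\mathcal{F}\subseteq\binom{[n]}{k}$, $f_{\mathcal{F}}:\{0,1\}^n\to[0,1]$ is $f_{\mathcal{F}}(x)=0$ if $|x|<k$ and $f_{\mathcal{F}}(x)=\Pr_{\mathbf{A}\sim\binom{x}{k}}[\mathbf{A}\in\mathcal{F}]$ (uniform $k$-subset of $x$) if $|x|\ge k$.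
   Formalization: The parameters ε and q range over the rationals. -}

module Defs where

open import Data.Nat as ℕ using (ℕ; zero; suc)
open import Data.Nat.Combinatorics using (_C_)
open import Data.Integer using (+_)
open import Data.Bool using (Bool; true; false; _∧_; if_then_else_)
open import Data.List using (List; []; _∷_; map; _++_; filter; length; foldr)
open import Data.Vec using (Vec; []; _∷_)
open import Data.Fin.Subset using (Subset; ∣_∣)
open import Data.Rational using (ℚ; 0ℚ; 1ℚ; _/_; _+_; _*_; _-_)

allSubsets : (n : ℕ) → List (Subset n)
allSubsets zero = [] ∷ []
allSubsets (suc n) = map (true ∷_) (allSubsets n) ++ map (false ∷_) (allSubsets n)

_⊆ᵇ_ : {n : ℕ} → Subset n → Subset n → Bool
[] ⊆ᵇ [] = true
(true ∷ a) ⊆ᵇ (false ∷ x) = false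
(_ ∷ a) ⊆ᵇ (_ ∷ x) = a ⊆ᵇ x

-- m / d as a rational, with the convention m / 0 = 0.
_÷ℕ_ : ℕ → ℕ → ℚ
m ÷ℕ zero = 0ℚ
m ÷ℕ suc d = (+ m) / suc d

_^ℚ_ : ℚ → ℕ → ℚ
q ^ℚ zero = 1ℚ
q ^ℚ suc m = q * (q ^ℚ m)

sumℚ : {A : Set} → (A → ℚ) → List A → ℚ
sumℚ f = foldr (λ a s → f a + s) 0ℚ

Family : ℕ → Set
Family n = Subset n → Bool

IsUniform : {n : ℕ} → ℕ → Family n → Set
IsUniform {n} k 𝓕 = (A : Subset n) → 𝓕 A ≡ true → ∣ A ∣ ≡ k
  where open import Relation.Binary.PropositionalEquality using (_≡_)

card : {n : ℕ} → Family n → ℕ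
card {n} 𝓕 = length (filter (λ A → 𝓕 A Data.Bool.≟ true) (allSubsets n))
  where import Data.Bool

μ : {n : ℕ} → ℕ → Family n → ℚ
μ {n} k 𝓕 = card 𝓕 ÷ℕ (n C k)

-- f_𝓕(x): probability that a uniformly random k-subset of x lies in 𝓕
-- (= 0 when |x| < k, since then binom(|x|,k) = 0 and the convention m/0 = 0 applies).
f[_] : {n : ℕ} → Family n → ℕ → Subset n → ℚ
f[_] {n} 𝓕 k x =
  length (filter (λ A → (𝓕 A ∧ (A ⊆ᵇ x)) Data.Bool.≟ true) (allSubsets n))
    ÷ℕ (∣ x ∣ C k)
  where import Data.Bool

μ[_] : ℚ → {n : ℕ} → (Subset n → ℚ) → ℚ
μ[_] q {n} g =
  sumℚ (λ x → (q ^ℚ ∣ x ∣) * ((1ℚ - q) ^ℚ (n ℕ.∸ ∣ x ∣)) * g x) (allSubsets n)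

-- Double counting over pairs (A, x) with A ∈ 𝓕 and A ⊆ x gives μ_q(f_𝓕) = |𝓕| · s, where
-- s = Σ_{x ⊇ A} μ_q(x) / C(|x|, k) is the same for every k-set A. Comparing with the family
-- of all k-sets, whose f is the indicator of |x| ≥ k, yields the identity
-- μ_q(f_𝓕) = μ_q(|x| ≥ k) · μ(𝓕). The first inequality follows at once; for the second,
-- |x| has mean qn ≥ k + εn and variance qn(1 - q) ≤ n under μ_q, so Chebyshev's inequality
-- gives μ_q(|x| < k) ≤ 1/(nε²), which is at most ε/(1 + ε) once nε³ ≥ 2.

{-# OPTIONS --safe #-}
module Submission where

open import Defs
open import Algebra.Bundles using (CommutativeMonoid)
open import Data.Bool using (Bool; true; false; _∧_; T)
import Data.Bool
open import Data.Bool.Properties using (∧-zeroʳ; ∧-identityʳ)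
open import Data.Empty using (⊥-elim)
open import Data.Fin.Subset using (Subset; ∣_∣; ⊤)
open import Data.Fin.Subset.Properties using (∣p∣≤n; ∣⊤∣≡n)
import Data.Integer as ℤ
import Data.Integer.Properties as ℤ
import Data.Integer.Tactic.RingSolver as ℤ-Solver
open import Data.List using (List; []; _∷_; map; _++_; filter; length)
open import Data.Nat as ℕ using (ℕ; zero; suc; _∸_; _≤ᵇ_; _≡ᵇ_; NonZero)
open import Data.Nat.Combinatorics using (_C_; nCk+nC[k+1]≡[n+1]C[k+1]; k>n⇒nCk≡0)
import Data.Nat.Properties as ℕ
open import Data.Product using (Σ; _×_; _,_)
open import Data.Rational
  using (ℚ; mkℚ; 0ℚ; 1ℚ; _≤_; _<_; _+_; _*_; _-_; -_; fromℚᵘ; toℚᵘ; *<*; nonNegative; positive)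
open import Data.Rational.Properties
import Data.Rational.Unnormalised as ℚᵘ
import Data.Rational.Unnormalised.Properties as ℚᵘ
open import Data.Sum using (inj₁; inj₂)
open import Data.Vec using ([]; _∷_)
open import Function using (_∘_)
open import Relation.Binary.PropositionalEquality
open import Relation.Nullary using (¬_; yes; no)
open import Relation.Nullary.Decidable using (dec⇒maybe)
open import Tactic.RingSolver using (solve-∀)
open import Tactic.RingSolver.Core.AlmostCommutativeRing using (AlmostCommutativeRing; fromCommutativeRing)

open import Algebra.Properties.CommutativeSemigroup
  (CommutativeMonoid.commutativeSemigroup *-1-commutativeMonoid) using (x∙yz≈y∙xz; x∙yz≈xz∙y)

private
  variable
    A : Set
    m n k : ℕ
    p q r ε : ℚ

-- Without the zero test the ring solver cannot cancel constant coefficients such as 1 - 1.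
ℚ-ring : AlmostCommutativeRing _ _
ℚ-ring = fromCommutativeRing +-*-commutativeRing (λ p → dec⇒maybe (0ℚ ≟ p))

fromℚᵘ-homo-+ : ∀ p q → fromℚᵘ (p ℚᵘ.+ q) ≡ fromℚᵘ p + fromℚᵘ q
fromℚᵘ-homo-+ p q = toℚᵘ-injective (begin-equality
  toℚᵘ (fromℚᵘ (p ℚᵘ.+ q))               ≃⟨ toℚᵘ-fromℚᵘ (p ℚᵘ.+ q) ⟩
  p ℚᵘ.+ q                                ≃⟨ ℚᵘ.+-cong (toℚᵘ-fromℚᵘ p) (toℚᵘ-fromℚᵘ q) ⟨
  toℚᵘ (fromℚᵘ p) ℚᵘ.+ toℚᵘ (fromℚᵘ q)   ≃⟨ toℚᵘ-homo-+ (fromℚᵘ p) (fromℚᵘ q) ⟨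
  toℚᵘ (fromℚᵘ p + fromℚᵘ q)             ∎)
  where open ℚᵘ.≤-Reasoning

0≤1 : 0ℚ ≤ 1ℚ
0≤1 = nonNegative⁻¹ 1ℚ

fromℕ : ℕ → ℚ
fromℕ zero    = 0ℚ
fromℕ (suc m) = 1ℚ + fromℕ m

fromℕ-+ : ∀ m n → fromℕ (m ℕ.+ n) ≡ fromℕ m + fromℕ n
fromℕ-+ zero    n = sym (+-identityˡ (fromℕ n))
fromℕ-+ (suc m) n = trans (cong (1ℚ +_) (fromℕ-+ m n)) (sym (+-assoc 1ℚ (fromℕ m) (fromℕ n)))

fromℕ-* : ∀ m n → fromℕ (m ℕ.* n) ≡ fromℕ m * fromℕ n
fromℕ-* zero    n = sym (*-zeroˡ (fromℕ n))
fromℕ-* (suc m) n = begin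
  fromℕ (n ℕ.+ m ℕ.* n)         ≡⟨ fromℕ-+ n (m ℕ.* n) ⟩
  fromℕ n + fromℕ (m ℕ.* n)     ≡⟨ cong (fromℕ n +_) (fromℕ-* m n) ⟩
  fromℕ n + fromℕ m * fromℕ n   ≡⟨ distrib (fromℕ m) (fromℕ n) ⟩
  fromℕ (suc m) * fromℕ n       ∎
  where
  open ≡-Reasoning
  distrib : ∀ x y → y + x * y ≡ (1ℚ + x) * y
  distrib = solve-∀ ℚ-ring

0≤fromℕ : ∀ m → 0ℚ ≤ fromℕ m
0≤fromℕ zero    = ≤-refl
0≤fromℕ (suc m) = +-mono-≤ 0≤1 (0≤fromℕ m)

fromℕ-mono-≤ : m ℕ.≤ n → fromℕ m ≤ fromℕ n
fromℕ-mono-≤ {n = n} ℕ.z≤n = 0≤fromℕ n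
fromℕ-mono-≤ (ℕ.s≤s m≤n)   = +-monoʳ-≤ 1ℚ (fromℕ-mono-≤ m≤n)

0<fromℕ : ∀ n .{{_ : NonZero n}} → 0ℚ < fromℕ n
0<fromℕ (suc n) = <-≤-trans (positive⁻¹ 1ℚ) (+-monoʳ-≤ 1ℚ (0≤fromℕ n))

𝟙 : Bool → ℚ
𝟙 true  = 1ℚ
𝟙 false = 0ℚ

𝟙≤1 : ∀ b → 𝟙 b ≤ 1ℚ
𝟙≤1 true  = ≤-refl
𝟙≤1 false = 0≤1

𝟙-true : ∀ {b} → T b → 𝟙 b ≡ 1ℚ
𝟙-true {true} _ = refl

𝟙-false : ∀ {b} → ¬ T b → 𝟙 b ≡ 0ℚ
𝟙-false {true}  ¬t = ⊥-elim (¬t _)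
𝟙-false {false} _  = refl

𝟙-∧ : ∀ a b → 𝟙 (a ∧ b) ≡ 𝟙 a * 𝟙 b
𝟙-∧ true  b = sym (*-identityˡ (𝟙 b))
𝟙-∧ false b = sym (*-zeroˡ (𝟙 b))

÷ℕ-suc : ∀ m c → suc m ÷ℕ c ≡ 1 ÷ℕ c + m ÷ℕ c
÷ℕ-suc m zero    = refl
÷ℕ-suc m (suc d) =
  trans (fromℚᵘ-cong split) (fromℚᵘ-homo-+ (ℚᵘ.mkℚᵘ (ℤ.+ 1) d) (ℚᵘ.mkℚᵘ (ℤ.+ m) d))
  where
  cross : ∀ i j → (ℤ.+ 1 ℤ.+ i) ℤ.* ((ℤ.+ 1 ℤ.+ j) ℤ.* (ℤ.+ 1 ℤ.+ j))
                ≡ (ℤ.+ 1 ℤ.* (ℤ.+ 1 ℤ.+ j) ℤ.+ i ℤ.* (ℤ.+ 1 ℤ.+ j)) ℤ.* (ℤ.+ 1 ℤ.+ j)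
  cross = ℤ-Solver.solve-∀
  split : ℚᵘ.mkℚᵘ (ℤ.+ suc m) d ℚᵘ.≃ ℚᵘ.mkℚᵘ (ℤ.+ 1) d ℚᵘ.+ ℚᵘ.mkℚᵘ (ℤ.+ m) d
  split = ℚᵘ.*≡* (cross (ℤ.+ m) (ℤ.+ d))

÷ℕ≡fromℕ*1÷ℕ : ∀ m c → m ÷ℕ c ≡ fromℕ m * (1 ÷ℕ c)
÷ℕ≡fromℕ*1÷ℕ zero    zero    = refl
÷ℕ≡fromℕ*1÷ℕ zero    (suc d) = trans (0/n≡0 (suc d)) (sym (*-zeroˡ (1 ÷ℕ suc d)))
÷ℕ≡fromℕ*1÷ℕ (suc m) c       = begin
  suc m ÷ℕ c                           ≡⟨ ÷ℕ-suc m c ⟩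
  1 ÷ℕ c + m ÷ℕ c                      ≡⟨ cong₂ _+_ (sym (*-identityˡ (1 ÷ℕ c))) (÷ℕ≡fromℕ*1÷ℕ m c) ⟩
  1ℚ * (1 ÷ℕ c) + fromℕ m * (1 ÷ℕ c)   ≡⟨ *-distribʳ-+ (1 ÷ℕ c) 1ℚ (fromℕ m) ⟨
  fromℕ (suc m) * (1 ÷ℕ c)             ∎
  where open ≡-Reasoning

fromℕ*1÷ℕ : ∀ c .{{_ : NonZero c}} → fromℕ c * (1 ÷ℕ c) ≡ 1ℚ
fromℕ*1÷ℕ (suc d) = trans (sym (÷ℕ≡fromℕ*1÷ℕ (suc d) (suc d)))
  (fromℚᵘ-cong cancel)
  where
  cancel : ℚᵘ.mkℚᵘ (ℤ.+ suc d) d ℚᵘ.≃ ℚᵘ.1ℚᵘ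
  cancel = ℚᵘ.*≡* (ℤ.*-comm (ℤ.+ suc d) (ℤ.+ 1))

0≤1÷ℕ : ∀ c → 0ℚ ≤ 1 ÷ℕ c
0≤1÷ℕ zero    = ≤-refl
0≤1÷ℕ (suc d) = nonNegative⁻¹ _ {{normalize-nonNeg 1 (suc d)}}

*-monoˡ-≤-0≤ : 0ℚ ≤ r → p ≤ q → r * p ≤ r * q
*-monoˡ-≤-0≤ {r} 0≤r = *-monoˡ-≤-nonNeg r {{nonNegative 0≤r}}

*-monoʳ-≤-0≤ : 0ℚ ≤ r → p ≤ q → p * r ≤ q * r
*-monoʳ-≤-0≤ {r} 0≤r = *-monoʳ-≤-nonNeg r {{nonNegative 0≤r}}

0≤* : 0ℚ ≤ p → 0ℚ ≤ q → 0ℚ ≤ p * q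
0≤* {p} 0≤p 0≤q = subst (_≤ p * _) (*-zeroʳ p) (*-monoˡ-≤-0≤ 0≤p 0≤q)

p≤q⇒0≤q-p : p ≤ q → 0ℚ ≤ q - p
p≤q⇒0≤q-p {p} {q} p≤q = subst (_≤ q - p) (+-inverseʳ p) (+-monoˡ-≤ (- p) p≤q)

0≤^ℚ : 0ℚ ≤ p → ∀ m → 0ℚ ≤ p ^ℚ m
0≤^ℚ 0≤p zero    = 0≤1
0≤^ℚ 0≤p (suc m) = 0≤* 0≤p (0≤^ℚ 0≤p m)

0≤p*p : ∀ p → 0ℚ ≤ p * p
0≤p*p p with ≤-total 0ℚ p
... | inj₁ 0≤p = 0≤* 0≤p 0≤p
... | inj₂ p≤0 = subst (0ℚ ≤_) (negSquare p) (0≤* (neg-antimono-≤ p≤0) (neg-antimono-≤ p≤0))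
  where
  negSquare : ∀ p → (- p) * (- p) ≡ p * p
  negSquare = solve-∀ ℚ-ring

*-self-mono-≤ : 0ℚ ≤ p → p ≤ q → p * p ≤ q * q
*-self-mono-≤ 0≤p p≤q = ≤-trans (*-monoʳ-≤-0≤ 0≤p p≤q) (*-monoˡ-≤-0≤ (≤-trans 0≤p p≤q) p≤q)

cube-mono-≤ : 0ℚ ≤ p → p ≤ q → p * p * p ≤ q * q * q
cube-mono-≤ {p} {q} 0≤p p≤q = ≤-trans (*-monoʳ-≤-0≤ 0≤p (*-self-mono-≤ 0≤p p≤q))
                              (*-monoˡ-≤-0≤ (0≤p*p q) p≤q)

p+q≤r⇒q≤r-p : p + q ≤ r → q ≤ r - p
p+q≤r⇒q≤r-p {p} {q} {r} p+q≤r = subst (_≤ r - p) (cancel p q) (+-monoˡ-≤ (- p) p+q≤r)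
  where
  cancel : ∀ p q → p + q - p ≡ q
  cancel = solve-∀ ℚ-ring

q*[1-q]≤1 : 0ℚ ≤ q → q ≤ 1ℚ → q * (1ℚ - q) ≤ 1ℚ
q*[1-q]≤1 0≤q q≤1 = ≤-trans (*-monoʳ-≤-0≤ (p≤q⇒0≤q-p q≤1) q≤1)
                            (*-monoˡ-≤-0≤ 0≤1 (+-monoʳ-≤ 1ℚ (neg-antimono-≤ 0≤q)))

0≤÷ℕ : ∀ m c → 0ℚ ≤ m ÷ℕ c
0≤÷ℕ m c = subst (0ℚ ≤_) (sym (÷ℕ≡fromℕ*1÷ℕ m c)) (0≤* (0≤fromℕ m) (0≤1÷ℕ c))

fromℕ*÷ℕ : ∀ m n .{{_ : NonZero n}} → fromℕ n * (m ÷ℕ n) ≡ fromℕ m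
fromℕ*÷ℕ m n = begin
  fromℕ n * (m ÷ℕ n)                ≡⟨ cong (fromℕ n *_) (÷ℕ≡fromℕ*1÷ℕ m n) ⟩
  fromℕ n * (fromℕ m * (1 ÷ℕ n))    ≡⟨ x∙yz≈y∙xz (fromℕ n) (fromℕ m) (1 ÷ℕ n) ⟩
  fromℕ m * (fromℕ n * (1 ÷ℕ n))    ≡⟨ cong (fromℕ m *_) (fromℕ*1÷ℕ n) ⟩
  fromℕ m * 1ℚ                      ≡⟨ *-identityʳ (fromℕ m) ⟩
  fromℕ m                           ∎
  where open ≡-Reasoning

count : (A → Bool) → List A → ℕ
count p xs = length (filter (λ a → p a Data.Bool.≟ true) xs)

sumℚ-++ : (f : A → ℚ) (xs ys : List A) → sumℚ f (xs ++ ys) ≡ sumℚ f xs + sumℚ f ys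
sumℚ-++ f []       ys = sym (+-identityˡ (sumℚ f ys))
sumℚ-++ f (x ∷ xs) ys = trans (cong (f x +_) (sumℚ-++ f xs ys)) (sym (+-assoc (f x) _ _))

sumℚ-map : {B : Set} (f : B → ℚ) (g : A → B) (xs : List A) → sumℚ f (map g xs) ≡ sumℚ (f ∘ g) xs
sumℚ-map f g []       = refl
sumℚ-map f g (x ∷ xs) = cong (f (g x) +_) (sumℚ-map f g xs)

sumℚ-cong : {f g : A → ℚ} (xs : List A) → (∀ a → f a ≡ g a) → sumℚ f xs ≡ sumℚ g xs
sumℚ-cong []       f≗g = refl
sumℚ-cong (x ∷ xs) f≗g = cong₂ _+_ (f≗g x) (sumℚ-cong xs f≗g)

sumℚ-zero : {f : A → ℚ} (xs : List A) → (∀ a → f a ≡ 0ℚ) → sumℚ f xs ≡ 0ℚ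
sumℚ-zero []       f≗0 = refl
sumℚ-zero (x ∷ xs) f≗0 = trans (cong₂ _+_ (f≗0 x) (sumℚ-zero xs f≗0)) (+-identityˡ 0ℚ)

sumℚ-+ : (f g : A → ℚ) (xs : List A) → sumℚ (λ a → f a + g a) xs ≡ sumℚ f xs + sumℚ g xs
sumℚ-+ f g []       = refl
sumℚ-+ f g (x ∷ xs) = trans (cong (f x + g x +_) (sumℚ-+ f g xs))
  (interchange (f x) (g x) (sumℚ f xs) (sumℚ g xs))
  where
  interchange : ∀ a b c d → (a + b) + (c + d) ≡ (a + c) + (b + d)
  interchange = solve-∀ ℚ-ring

sumℚ-*ˡ : (c : ℚ) (f : A → ℚ) (xs : List A) → sumℚ (λ a → c * f a) xs ≡ c * sumℚ f xs
sumℚ-*ˡ c f []       = sym (*-zeroʳ c)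
sumℚ-*ˡ c f (x ∷ xs) = trans (cong (c * f x +_) (sumℚ-*ˡ c f xs)) (sym (*-distribˡ-+ c (f x) _))

sumℚ-mono : {f g : A → ℚ} (xs : List A) → (∀ a → f a ≤ g a) → sumℚ f xs ≤ sumℚ g xs
sumℚ-mono []       f≤g = ≤-refl
sumℚ-mono (x ∷ xs) f≤g = +-mono-≤ (f≤g x) (sumℚ-mono xs f≤g)

sumℚ-comm : {B : Set} (F : A → B → ℚ) (xs : List A) (ys : List B) →
  sumℚ (λ a → sumℚ (F a) ys) xs ≡ sumℚ (λ b → sumℚ (λ a → F a b) xs) ys
sumℚ-comm F []       ys = sym (sumℚ-zero ys (λ _ → refl))
sumℚ-comm F (x ∷ xs) ys = trans (cong (sumℚ (F x) ys +_) (sumℚ-comm F xs ys))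
  (sym (sumℚ-+ (F x) (λ b → sumℚ (λ a → F a b) xs) ys))

fromℕ-count : (p : A → Bool) (xs : List A) → fromℕ (count p xs) ≡ sumℚ (𝟙 ∘ p) xs
fromℕ-count p []       = refl
fromℕ-count p (x ∷ xs) with p x
... | true  = cong (1ℚ +_) (fromℕ-count p xs)
... | false = trans (fromℕ-count p xs) (sym (+-identityˡ _))

-- Sums over the cube {0,1}ⁿ

sumℚ-allSubsets-suc : (f : Subset (suc n) → ℚ) → sumℚ f (allSubsets (suc n)) ≡
  sumℚ (f ∘ (true ∷_)) (allSubsets n) + sumℚ (f ∘ (false ∷_)) (allSubsets n)
sumℚ-allSubsets-suc {n} f = trans (sumℚ-++ f (map (true ∷_) (allSubsets n)) _)
  (cong₂ _+_ (sumℚ-map f (true ∷_) (allSubsets n)) (sumℚ-map f (false ∷_) (allSubsets n)))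

-- binomialSum m g = ∑ⱼ (m C j) * g j, computed through Pascal's rule.
binomialSum : ℕ → (ℕ → ℚ) → ℚ
binomialSum zero    g = g 0
binomialSum (suc m) g = binomialSum m (g ∘ suc) + binomialSum m g

binomialSum-cong : ∀ m {g h : ℕ → ℚ} → (∀ j → g j ≡ h j) → binomialSum m g ≡ binomialSum m h
binomialSum-cong zero    g≗h = g≗h 0
binomialSum-cong (suc m) g≗h = cong₂ _+_ (binomialSum-cong m (g≗h ∘ suc)) (binomialSum-cong m g≗h)

sumℚ-supersets : (g : ℕ → ℚ) (a : Subset n) →
  sumℚ (λ x → g ∣ x ∣ * 𝟙 (a ⊆ᵇ x)) (allSubsets n)
    ≡ binomialSum (n ∸ ∣ a ∣) (λ j → g (∣ a ∣ ℕ.+ j))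
sumℚ-supersets {zero}  g []          = trans (+-identityʳ _) (*-identityʳ (g 0))
sumℚ-supersets {suc n} g (true ∷ a)  = begin
  sumℚ (λ x → g ∣ x ∣ * 𝟙 ((true ∷ a) ⊆ᵇ x)) (allSubsets (suc n))
    ≡⟨ sumℚ-allSubsets-suc (λ x → g ∣ x ∣ * 𝟙 ((true ∷ a) ⊆ᵇ x)) ⟩
  sumℚ (λ x → g (suc ∣ x ∣) * 𝟙 (a ⊆ᵇ x)) (allSubsets n) + sumℚ (λ x → g ∣ x ∣ * 0ℚ) (allSubsets n)
    ≡⟨ cong₂ _+_ (sumℚ-supersets (g ∘ suc) a) (sumℚ-zero (allSubsets n) (λ x → *-zeroʳ (g ∣ x ∣))) ⟩
  binomialSum (n ∸ ∣ a ∣) (λ j → g (suc ∣ a ∣ ℕ.+ j)) + 0ℚ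
    ≡⟨ +-identityʳ _ ⟩
  binomialSum (n ∸ ∣ a ∣) (λ j → g (suc ∣ a ∣ ℕ.+ j))
    ∎
  where open ≡-Reasoning
sumℚ-supersets {suc n} g (false ∷ a) = begin
  sumℚ (λ x → g ∣ x ∣ * 𝟙 ((false ∷ a) ⊆ᵇ x)) (allSubsets (suc n))
    ≡⟨ sumℚ-allSubsets-suc (λ x → g ∣ x ∣ * 𝟙 ((false ∷ a) ⊆ᵇ x)) ⟩
  sumℚ (λ x → g (suc ∣ x ∣) * 𝟙 (a ⊆ᵇ x)) (allSubsets n)
    + sumℚ (λ x → g ∣ x ∣ * 𝟙 (a ⊆ᵇ x)) (allSubsets n)
    ≡⟨ cong₂ _+_ (sumℚ-supersets (g ∘ suc) a) (sumℚ-supersets g a) ⟩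
  binomialSum (n ∸ ∣ a ∣) (λ j → g (suc (∣ a ∣ ℕ.+ j)))
    + binomialSum (n ∸ ∣ a ∣) (λ j → g (∣ a ∣ ℕ.+ j))
    ≡⟨ cong (_+ binomialSum (n ∸ ∣ a ∣) (λ j → g (∣ a ∣ ℕ.+ j)))
         (binomialSum-cong (n ∸ ∣ a ∣) (λ j → cong g (sym (ℕ.+-suc ∣ a ∣ j)))) ⟩
  binomialSum (suc (n ∸ ∣ a ∣)) (λ j → g (∣ a ∣ ℕ.+ j))
    ≡⟨ cong (λ t → binomialSum t (λ j → g (∣ a ∣ ℕ.+ j))) (ℕ.+-∸-assoc 1 (∣p∣≤n a)) ⟨
  binomialSum (suc n ∸ ∣ a ∣) (λ j → g (∣ a ∣ ℕ.+ j))
    ∎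
  where open ≡-Reasoning

sumℚ-kSubsets : (k : ℕ) (x : Subset n) →
  sumℚ (λ a → 𝟙 ((∣ a ∣ ≡ᵇ k) ∧ (a ⊆ᵇ x))) (allSubsets n) ≡ fromℕ (∣ x ∣ C k)
sumℚ-kSubsets {zero}  zero    []          = refl
sumℚ-kSubsets {zero}  (suc k) []          = refl
sumℚ-kSubsets {suc n} k       (true ∷ x)  =
  trans (sumℚ-allSubsets-suc (λ a → 𝟙 ((∣ a ∣ ≡ᵇ k) ∧ (a ⊆ᵇ (true ∷ x))))) (pascal k)
  where
  pascal : ∀ k → sumℚ (λ a → 𝟙 ((suc ∣ a ∣ ≡ᵇ k) ∧ (a ⊆ᵇ x))) (allSubsets n)
               + sumℚ (λ a → 𝟙 ((∣ a ∣ ≡ᵇ k) ∧ (a ⊆ᵇ x))) (allSubsets n)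
               ≡ fromℕ (suc ∣ x ∣ C k)
  pascal zero    = trans (cong₂ _+_ (sumℚ-zero (allSubsets n) (λ _ → refl)) (sumℚ-kSubsets zero x))
                         (+-identityˡ (fromℕ (∣ x ∣ C 0)))
  pascal (suc k) = trans (cong₂ _+_ (sumℚ-kSubsets k x) (sumℚ-kSubsets (suc k) x))
                         (trans (sym (fromℕ-+ (∣ x ∣ C k) (∣ x ∣ C suc k)))
                                (cong fromℕ (nCk+nC[k+1]≡[n+1]C[k+1] ∣ x ∣ k)))
sumℚ-kSubsets {suc n} k       (false ∷ x) =
  trans (sumℚ-allSubsets-suc (λ a → 𝟙 ((∣ a ∣ ≡ᵇ k) ∧ (a ⊆ᵇ (false ∷ x)))))
        (trans (cong₂ _+_ (sumℚ-zero (allSubsets n) (λ a → cong 𝟙 (∧-zeroʳ (suc ∣ a ∣ ≡ᵇ k))))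
                          (sumℚ-kSubsets k x))
               (+-identityˡ (fromℕ (∣ x ∣ C k))))

k≤n⇒nCk>0 : k ℕ.≤ n → n C k ℕ.> 0
k≤n⇒nCk>0 {zero}  _             = ℕ.s≤s ℕ.z≤n
k≤n⇒nCk>0 {suc k} {suc n} (ℕ.s≤s k≤n) = ℕ.<-≤-trans (k≤n⇒nCk>0 k≤n)
  (subst (n C k ℕ.≤_) (nCk+nC[k+1]≡[n+1]C[k+1] n k) (ℕ.m≤m+n (n C k) (n C suc k)))

fromℕ[nCk]*1÷ℕ[nCk] : ∀ n k → fromℕ (n C k) * (1 ÷ℕ (n C k)) ≡ 𝟙 (k ≤ᵇ n)
fromℕ[nCk]*1÷ℕ[nCk] n k with k ℕ.≤? n
... | yes k≤n = trans (fromℕ*1÷ℕ (n C k) {{ℕ.>-nonZero (k≤n⇒nCk>0 k≤n)}})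
                      (sym (𝟙-true (ℕ.≤⇒≤ᵇ k≤n)))
... | no  k≰n = trans (cong (λ c → fromℕ c * (1 ÷ℕ c)) (k>n⇒nCk≡0 (ℕ.≰⇒> k≰n)))
                      (sym (𝟙-false (k≰n ∘ ℕ.≤ᵇ⇒≤ k n)))

-- The q-biased measure

weight : ℚ → (n : ℕ) → Subset n → ℚ
weight q n x = q ^ℚ ∣ x ∣ * (1ℚ - q) ^ℚ (n ∸ ∣ x ∣)

μ-cong : ∀ {n q} {f g : Subset n → ℚ} → (∀ x → f x ≡ g x) → μ[ q ] f ≡ μ[ q ] g
μ-cong {n} {q} f≗g = sumℚ-cong (allSubsets n) (λ x → cong (weight q n x *_) (f≗g x))

μ-+ : ∀ {n q} (f g : Subset n → ℚ) → μ[ q ] (λ x → f x + g x) ≡ μ[ q ] f + μ[ q ] g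
μ-+ {n} {q} f g = trans (sumℚ-cong (allSubsets n) (λ x → *-distribˡ-+ (weight q n x) (f x) (g x)))
  (sumℚ-+ (λ x → weight q n x * f x) (λ x → weight q n x * g x) (allSubsets n))

μ-*ˡ : ∀ {n q} (c : ℚ) (f : Subset n → ℚ) → μ[ q ] (λ x → c * f x) ≡ c * μ[ q ] f
μ-*ˡ {n} {q} c f = trans (sumℚ-cong (allSubsets n) (λ x → x∙yz≈y∙xz (weight q n x) c (f x)))
  (sumℚ-*ˡ c (λ x → weight q n x * f x) (allSubsets n))

μ-mono : ∀ {n q} → 0ℚ ≤ q → q ≤ 1ℚ →
  {f g : Subset n → ℚ} → (∀ x → f x ≤ g x) → μ[ q ] f ≤ μ[ q ] g
μ-mono {n} {q} 0≤q q≤1 f≤g = sumℚ-mono (allSubsets n) (λ x → *-monoˡ-≤-0≤ (0≤weight x) (f≤g x))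
  where
  0≤weight : ∀ x → 0ℚ ≤ weight q n x
  0≤weight x = 0≤* (0≤^ℚ 0≤q ∣ x ∣) (0≤^ℚ (p≤q⇒0≤q-p q≤1) (n ∸ ∣ x ∣))

μ-suc : ∀ {n q} (f : Subset (suc n) → ℚ) →
  μ[ q ] f ≡ q * μ[ q ] (f ∘ (true ∷_)) + (1ℚ - q) * μ[ q ] (f ∘ (false ∷_))
μ-suc {n} {q} f = trans (sumℚ-allSubsets-suc (λ x → weight q (suc n) x * f x)) (cong₂ _+_
  (trans (sumℚ-cong 𝒫 inside)  (sumℚ-*ˡ q        (λ x → weight q n x * f (true ∷ x)) 𝒫))
  (trans (sumℚ-cong 𝒫 outside) (sumℚ-*ˡ (1ℚ - q) (λ x → weight q n x * f (false ∷ x)) 𝒫)))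
  where
  𝒫 : List (Subset n)
  𝒫 = allSubsets n
  factorˡ : ∀ r a b c → r * a * b * c ≡ r * (a * b * c)
  factorˡ = solve-∀ ℚ-ring
  factorʳ : ∀ r a b c → a * (r * b) * c ≡ r * (a * b * c)
  factorʳ = solve-∀ ℚ-ring
  inside : ∀ x → weight q (suc n) (true ∷ x) * f (true ∷ x) ≡ q * (weight q n x * f (true ∷ x))
  inside x = factorˡ q (q ^ℚ ∣ x ∣) ((1ℚ - q) ^ℚ (n ∸ ∣ x ∣)) (f (true ∷ x))
  outside : ∀ x → weight q (suc n) (false ∷ x) * f (false ∷ x) ≡ (1ℚ - q) * (weight q n x * f (false ∷ x))
  outside x = trans (cong (λ e → q ^ℚ ∣ x ∣ * (1ℚ - q) ^ℚ e * f (false ∷ x)) (ℕ.+-∸-assoc 1 (∣p∣≤n x)))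
                    (factorʳ (1ℚ - q) (q ^ℚ ∣ x ∣) ((1ℚ - q) ^ℚ (n ∸ ∣ x ∣)) (f (false ∷ x)))

μ-1 : ∀ {q} n → μ[ q ] {n} (λ _ → 1ℚ) ≡ 1ℚ
μ-1         zero    = refl
μ-1 {q} (suc n) = trans (μ-suc {n} {q} (λ _ → 1ℚ))
  (trans (cong₂ (λ s t → q * s + (1ℚ - q) * t) (μ-1 {q} n) (μ-1 {q} n)) (total q))
  where
  total : ∀ q → q * 1ℚ + (1ℚ - q) * 1ℚ ≡ 1ℚ
  total = solve-∀ ℚ-ring

μ-const : ∀ {n q} (c : ℚ) → μ[ q ] {n} (λ _ → c) ≡ c
μ-const {n} {q} c = begin
  μ[ q ] {n} (λ _ → c)        ≡⟨ μ-cong {n} {q} (λ _ → *-identityʳ c) ⟨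
  μ[ q ] {n} (λ _ → c * 1ℚ)   ≡⟨ μ-*ˡ {n} {q} c (λ _ → 1ℚ) ⟩
  c * μ[ q ] {n} (λ _ → 1ℚ)   ≡⟨ cong (c *_) (μ-1 {q} n) ⟩
  c * 1ℚ                      ≡⟨ *-identityʳ c ⟩
  c                           ∎
  where open ≡-Reasoning

μ-complement : ∀ {n q} (f : Subset n → ℚ) (c : ℚ) →
  μ[ q ] (λ x → (1ℚ - f x) * c) ≡ (1ℚ - μ[ q ] f) * c
μ-complement {n} {q} f c = begin
  μ[ q ] (λ x → (1ℚ - f x) * c)          ≡⟨ μ-cong (λ x → expand (f x) c) ⟩
  μ[ q ] (λ x → c + (- c) * f x)         ≡⟨ μ-+ (λ _ → c) (λ x → (- c) * f x) ⟩
  μ[ q ] {n} (λ _ → c) + μ[ q ] (λ x → (- c) * f x)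
                                       ≡⟨ cong₂ _+_ (μ-const {n} {q} c) (μ-*ˡ (- c) f) ⟩
  c + (- c) * μ[ q ] f                 ≡⟨ expand (μ[ q ] f) c ⟨
  (1ℚ - μ[ q ] f) * c                  ∎
  where
  open ≡-Reasoning
  expand : ∀ y c → (1ℚ - y) * c ≡ c + (- c) * y
  expand = solve-∀ ℚ-ring

-- Generalising over a lets the induction absorb the shift ∣ true ∷ x ∣ = 1 + ∣ x ∣.
μ-squaredDistance : ∀ {q} n (a : ℚ) →
  μ[ q ] {n} (λ x → (fromℕ ∣ x ∣ - a) * (fromℕ ∣ x ∣ - a))
    ≡ fromℕ n * q * (1ℚ - q) + (fromℕ n * q - a) * (fromℕ n * q - a)
μ-squaredDistance {q} zero    a = base q a
  where
  base : ∀ q a → 1ℚ * 1ℚ * ((0ℚ - a) * (0ℚ - a)) + 0ℚ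
               ≡ 0ℚ * q * (1ℚ - q) + (0ℚ * q - a) * (0ℚ * q - a)
  base = solve-∀ ℚ-ring
μ-squaredDistance {q} (suc n) a = begin
  μ[ q ] {suc n} (λ x → (fromℕ ∣ x ∣ - a) * (fromℕ ∣ x ∣ - a))
    ≡⟨ μ-suc {n} {q} (λ x → (fromℕ ∣ x ∣ - a) * (fromℕ ∣ x ∣ - a)) ⟩
  q * μ[ q ] {n} (λ x → (1ℚ + fromℕ ∣ x ∣ - a) * (1ℚ + fromℕ ∣ x ∣ - a))
    + (1ℚ - q) * μ[ q ] {n} (λ x → (fromℕ ∣ x ∣ - a) * (fromℕ ∣ x ∣ - a))
    ≡⟨ cong₂ (λ s t → q * s + (1ℚ - q) * t)
         (trans (μ-cong {n} {q} (λ x → shift (fromℕ ∣ x ∣) a)) (μ-squaredDistance n (a - 1ℚ)))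
         (μ-squaredDistance n a) ⟩
  q * (fromℕ n * q * (1ℚ - q) + (fromℕ n * q - (a - 1ℚ)) * (fromℕ n * q - (a - 1ℚ)))
    + (1ℚ - q) * (fromℕ n * q * (1ℚ - q) + (fromℕ n * q - a) * (fromℕ n * q - a))
    ≡⟨ step (fromℕ n) q a ⟩
  fromℕ (suc n) * q * (1ℚ - q) + (fromℕ (suc n) * q - a) * (fromℕ (suc n) * q - a)
    ∎
  where
  open ≡-Reasoning
  shift : ∀ y a → (1ℚ + y - a) * (1ℚ + y - a) ≡ (y - (a - 1ℚ)) * (y - (a - 1ℚ))
  shift = solve-∀ ℚ-ring
  step : ∀ N q a → q * (N * q * (1ℚ - q) + (N * q - (a - 1ℚ)) * (N * q - (a - 1ℚ)))
                   + (1ℚ - q) * (N * q * (1ℚ - q) + (N * q - a) * (N * q - a))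
                 ≡ (1ℚ + N) * q * (1ℚ - q) + ((1ℚ + N) * q - a) * ((1ℚ + N) * q - a)
  step = solve-∀ ℚ-ring

upperTail : ℚ → (n k : ℕ) → ℚ
upperTail q n k = μ[ q ] {n} (λ x → 𝟙 (k ≤ᵇ ∣ x ∣))

upperTail≤1 : ∀ {q n k} → 0ℚ ≤ q → q ≤ 1ℚ → upperTail q n k ≤ 1ℚ
upperTail≤1 {q} {n} {k} 0≤q q≤1 =
  subst (upperTail q n k ≤_) (μ-1 n) (μ-mono {n} {q} 0≤q q≤1 (λ x → 𝟙≤1 (k ≤ᵇ ∣ x ∣)))

chebyshev-pointwise : ∀ {k d a} → 0ℚ ≤ d → fromℕ k + d ≤ a →
  ∀ j → (1ℚ - 𝟙 (k ≤ᵇ j)) * (d * d) ≤ (fromℕ j - a) * (fromℕ j - a)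
chebyshev-pointwise {k} {d} {a} 0≤d k+d≤a j with k ℕ.≤? j
... | yes k≤j = begin
  (1ℚ - 𝟙 (k ≤ᵇ j)) * (d * d)   ≡⟨ cong (λ t → (1ℚ - t) * (d * d)) (𝟙-true (ℕ.≤⇒≤ᵇ k≤j)) ⟩
  0ℚ * (d * d)                  ≡⟨ *-zeroˡ (d * d) ⟩
  0ℚ                            ≤⟨ 0≤p*p (fromℕ j - a) ⟩
  (fromℕ j - a) * (fromℕ j - a) ∎
  where open ≤-Reasoning
... | no  k≰j = begin
  (1ℚ - 𝟙 (k ≤ᵇ j)) * (d * d)   ≡⟨ cong (λ t → (1ℚ - t) * (d * d)) (𝟙-false (k≰j ∘ ℕ.≤ᵇ⇒≤ k j)) ⟩
  1ℚ * (d * d)                  ≡⟨ *-identityˡ (d * d) ⟩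
  d * d                         ≤⟨ *-self-mono-≤ 0≤d (p+q≤r⇒q≤r-p j+d≤a) ⟩
  (a - fromℕ j) * (a - fromℕ j) ≡⟨ flip a (fromℕ j) ⟩
  (fromℕ j - a) * (fromℕ j - a) ∎
  where
  open ≤-Reasoning
  j+d≤a : fromℕ j + d ≤ a
  j+d≤a = ≤-trans (+-monoˡ-≤ d (fromℕ-mono-≤ (ℕ.<⇒≤ (ℕ.≰⇒> k≰j)))) k+d≤a
  flip : ∀ a b → (a - b) * (a - b) ≡ (b - a) * (b - a)
  flip = solve-∀ ℚ-ring

chebyshev-lowerTail : ∀ {q n k d} → 0ℚ ≤ q → q ≤ 1ℚ → 0ℚ ≤ d → fromℕ k + d ≤ fromℕ n * q →
  (1ℚ - upperTail q n k) * (d * d) ≤ fromℕ n * q * (1ℚ - q)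
chebyshev-lowerTail {q} {n} {k} {d} 0≤q q≤1 0≤d k+d≤nq = begin
  (1ℚ - upperTail q n k) * (d * d)
    ≡⟨ μ-complement {n} {q} (λ x → 𝟙 (k ≤ᵇ ∣ x ∣)) (d * d) ⟨
  μ[ q ] {n} (λ x → (1ℚ - 𝟙 (k ≤ᵇ ∣ x ∣)) * (d * d))
    ≤⟨ μ-mono {n} {q} 0≤q q≤1 (λ x → chebyshev-pointwise {k} 0≤d k+d≤nq ∣ x ∣) ⟩
  μ[ q ] {n} (λ x → (fromℕ ∣ x ∣ - fromℕ n * q) * (fromℕ ∣ x ∣ - fromℕ n * q))
    ≡⟨ μ-squaredDistance n (fromℕ n * q) ⟩
  fromℕ n * q * (1ℚ - q) + (fromℕ n * q - fromℕ n * q) * (fromℕ n * q - fromℕ n * q)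
    ≡⟨ noDeviation (fromℕ n * q * (1ℚ - q)) (fromℕ n * q) ⟩
  fromℕ n * q * (1ℚ - q)
    ∎
  where
  open ≤-Reasoning
  noDeviation : ∀ v a → v + (a - a) * (a - a) ≡ v
  noDeviation = solve-∀ ℚ-ring

-- Double counting

𝟙-uniform : {𝓕 : Family n} → IsUniform k 𝓕 → (g : ℕ → ℚ) (a : Subset n) →
  𝟙 (𝓕 a) * g ∣ a ∣ ≡ 𝟙 (𝓕 a) * g k
𝟙-uniform {k = k} {𝓕 = 𝓕} uniform g a with 𝓕 a in 𝓕a≡true
... | true  = cong (λ s → 1ℚ * g s) (uniform a 𝓕a≡true)
... | false = trans (*-zeroˡ (g ∣ a ∣)) (sym (*-zeroˡ (g k)))

sumℚ-count-⊆ : {𝓕 : Family n} → IsUniform k 𝓕 → (g : ℕ → ℚ) →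
  sumℚ (λ x → g ∣ x ∣ * fromℕ (count (λ a → 𝓕 a ∧ (a ⊆ᵇ x)) (allSubsets n))) (allSubsets n)
    ≡ fromℕ (card 𝓕) * binomialSum (n ∸ k) (λ j → g (k ℕ.+ j))
sumℚ-count-⊆ {n} {k} {𝓕} uniform g = begin
  sumℚ (λ x → g ∣ x ∣ * fromℕ (count (λ a → 𝓕 a ∧ (a ⊆ᵇ x)) 𝒫)) 𝒫
    ≡⟨ sumℚ-cong 𝒫 (λ x → trans (cong (g ∣ x ∣ *_) (fromℕ-count (λ a → 𝓕 a ∧ (a ⊆ᵇ x)) 𝒫))
                                (sym (sumℚ-*ˡ (g ∣ x ∣) (λ a → 𝟙 (𝓕 a ∧ (a ⊆ᵇ x))) 𝒫))) ⟩
  sumℚ (λ x → sumℚ (λ a → g ∣ x ∣ * 𝟙 (𝓕 a ∧ (a ⊆ᵇ x))) 𝒫) 𝒫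
    ≡⟨ sumℚ-comm (λ x a → g ∣ x ∣ * 𝟙 (𝓕 a ∧ (a ⊆ᵇ x))) 𝒫 𝒫 ⟩
  sumℚ (λ a → sumℚ (λ x → g ∣ x ∣ * 𝟙 (𝓕 a ∧ (a ⊆ᵇ x))) 𝒫) 𝒫
    ≡⟨ sumℚ-cong 𝒫 supersetsOf ⟩
  sumℚ (λ a → B * 𝟙 (𝓕 a)) 𝒫
    ≡⟨ sumℚ-*ˡ B (𝟙 ∘ 𝓕) 𝒫 ⟩
  B * sumℚ (𝟙 ∘ 𝓕) 𝒫
    ≡⟨ cong (B *_) (fromℕ-count 𝓕 𝒫) ⟨
  B * fromℕ (card 𝓕)
    ≡⟨ *-comm B (fromℕ (card 𝓕)) ⟩
  fromℕ (card 𝓕) * B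
    ∎
  where
  open ≡-Reasoning
  𝒫 : List (Subset n)
  𝒫 = allSubsets n
  B : ℚ
  B = binomialSum (n ∸ k) (λ j → g (k ℕ.+ j))
  supersetsOf : ∀ a → sumℚ (λ x → g ∣ x ∣ * 𝟙 (𝓕 a ∧ (a ⊆ᵇ x))) 𝒫 ≡ B * 𝟙 (𝓕 a)
  supersetsOf a = begin
    sumℚ (λ x → g ∣ x ∣ * 𝟙 (𝓕 a ∧ (a ⊆ᵇ x))) 𝒫
      ≡⟨ sumℚ-cong 𝒫 (λ x → trans (cong (g ∣ x ∣ *_) (𝟙-∧ (𝓕 a) (a ⊆ᵇ x)))
                                  (x∙yz≈y∙xz (g ∣ x ∣) (𝟙 (𝓕 a)) (𝟙 (a ⊆ᵇ x)))) ⟩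
    sumℚ (λ x → 𝟙 (𝓕 a) * (g ∣ x ∣ * 𝟙 (a ⊆ᵇ x))) 𝒫
      ≡⟨ sumℚ-*ˡ (𝟙 (𝓕 a)) (λ x → g ∣ x ∣ * 𝟙 (a ⊆ᵇ x)) 𝒫 ⟩
    𝟙 (𝓕 a) * sumℚ (λ x → g ∣ x ∣ * 𝟙 (a ⊆ᵇ x)) 𝒫
      ≡⟨ cong (𝟙 (𝓕 a) *_) (sumℚ-supersets g a) ⟩
    𝟙 (𝓕 a) * binomialSum (n ∸ ∣ a ∣) (λ j → g (∣ a ∣ ℕ.+ j))
      ≡⟨ 𝟙-uniform uniform (λ s → binomialSum (n ∸ s) (λ j → g (s ℕ.+ j))) a ⟩
    𝟙 (𝓕 a) * B
      ≡⟨ *-comm (𝟙 (𝓕 a)) B ⟩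
    B * 𝟙 (𝓕 a)
      ∎

weightPerKSubset : ℚ → (n k m : ℕ) → ℚ
weightPerKSubset q n k m = q ^ℚ m * (1ℚ - q) ^ℚ (n ∸ m) * (1 ÷ℕ (m C k))

-- μ_q(f_{A}) for any single k-set A
singletonMass : ℚ → (n k : ℕ) → ℚ
singletonMass q n k = binomialSum (n ∸ k) (λ j → weightPerKSubset q n k (k ℕ.+ j))

μ-f≡card*singletonMass : {𝓕 : Family n} → IsUniform k 𝓕 →
  μ[ q ] (f[ 𝓕 ] k) ≡ fromℕ (card 𝓕) * singletonMass q n k
μ-f≡card*singletonMass {n} {k} {q} {𝓕} uniform = trans
  (sumℚ-cong (allSubsets n) (λ x → trans
    (cong (weight q n x *_) (÷ℕ≡fromℕ*1÷ℕ (N x) (∣ x ∣ C k)))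
    (x∙yz≈xz∙y (weight q n x) (fromℕ (N x)) (1 ÷ℕ (∣ x ∣ C k)))))
  (sumℚ-count-⊆ uniform (weightPerKSubset q n k))
  where
  N : Subset n → ℕ
  N x = count (λ a → 𝓕 a ∧ (a ⊆ᵇ x)) (allSubsets n)

kSets : ℕ → Family n
kSets k a = ∣ a ∣ ≡ᵇ k

kSets-uniform : IsUniform k (kSets {n} k)
kSets-uniform {k} a ∣a∣≡ᵇk = ℕ.≡ᵇ⇒≡ ∣ a ∣ k (subst T (sym ∣a∣≡ᵇk) _)

⊆ᵇ-⊤ : (a : Subset n) → (a ⊆ᵇ ⊤) ≡ true
⊆ᵇ-⊤ []          = refl
⊆ᵇ-⊤ (true ∷ a)  = ⊆ᵇ-⊤ a
⊆ᵇ-⊤ (false ∷ a) = ⊆ᵇ-⊤ a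

card-kSets : ∀ n k → fromℕ (card (kSets {n} k)) ≡ fromℕ (n C k)
card-kSets n k = begin
  fromℕ (card (kSets {n} k))                                ≡⟨ fromℕ-count (kSets k) (allSubsets n) ⟩
  sumℚ (λ a → 𝟙 (∣ a ∣ ≡ᵇ k)) (allSubsets n)               ≡⟨ sumℚ-cong (allSubsets n) (cong 𝟙 ∘ inside⊤) ⟩
  sumℚ (λ a → 𝟙 ((∣ a ∣ ≡ᵇ k) ∧ (a ⊆ᵇ ⊤))) (allSubsets n)  ≡⟨ sumℚ-kSubsets k (⊤ {n}) ⟩
  fromℕ (∣ ⊤ {n} ∣ C k)                                     ≡⟨ cong (λ m → fromℕ (m C k)) (∣⊤∣≡n n) ⟩
  fromℕ (n C k)                                             ∎
  where
  open ≡-Reasoning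
  inside⊤ : (a : Subset n) → (∣ a ∣ ≡ᵇ k) ≡ ((∣ a ∣ ≡ᵇ k) ∧ (a ⊆ᵇ ⊤))
  inside⊤ a = trans (sym (∧-identityʳ (∣ a ∣ ≡ᵇ k))) (cong ((∣ a ∣ ≡ᵇ k) ∧_) (sym (⊆ᵇ-⊤ a)))

f-kSets : ∀ k (x : Subset n) → f[ kSets k ] k x ≡ 𝟙 (k ≤ᵇ ∣ x ∣)
f-kSets {n} k x = begin
  f[ kSets k ] k x                          ≡⟨ ÷ℕ≡fromℕ*1÷ℕ (count kSubsetOfx 𝒫) (∣ x ∣ C k) ⟩
  fromℕ (count kSubsetOfx 𝒫) * (1 ÷ℕ c)     ≡⟨ cong (_* (1 ÷ℕ c)) (fromℕ-count kSubsetOfx 𝒫) ⟩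
  sumℚ (𝟙 ∘ kSubsetOfx) 𝒫 * (1 ÷ℕ c)        ≡⟨ cong (_* (1 ÷ℕ c)) (sumℚ-kSubsets k x) ⟩
  fromℕ c * (1 ÷ℕ c)                        ≡⟨ fromℕ[nCk]*1÷ℕ[nCk] ∣ x ∣ k ⟩
  𝟙 (k ≤ᵇ ∣ x ∣)                            ∎
  where
  open ≡-Reasoning
  𝒫 : List (Subset n)
  𝒫 = allSubsets n
  c : ℕ
  c = ∣ x ∣ C k
  kSubsetOfx : Subset n → Bool
  kSubsetOfx a = (∣ a ∣ ≡ᵇ k) ∧ (a ⊆ᵇ x)

upperTail≡nCk*singletonMass : ∀ q n k → upperTail q n k ≡ fromℕ (n C k) * singletonMass q n k
upperTail≡nCk*singletonMass q n k = begin
  upperTail q n k                                    ≡⟨ μ-cong {n} {q} (λ x → f-kSets k x) ⟨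
  μ[ q ] {n} (f[ kSets k ] k)                        ≡⟨ μ-f≡card*singletonMass {n} {k} {q} kSets-uniform ⟩
  fromℕ (card (kSets {n} k)) * singletonMass q n k   ≡⟨ cong (_* singletonMass q n k) (card-kSets n k) ⟩
  fromℕ (n C k) * singletonMass q n k                ∎
  where open ≡-Reasoning

μ-f≡upperTail*μ : {𝓕 : Family n} → k ℕ.≤ n → IsUniform k 𝓕 →
  μ[ q ] (f[ 𝓕 ] k) ≡ upperTail q n k * μ k 𝓕
μ-f≡upperTail*μ {n} {k} {q} {𝓕} k≤n uniform = begin
  μ[ q ] (f[ 𝓕 ] k)
    ≡⟨ μ-f≡card*singletonMass uniform ⟩
  fromℕ (card 𝓕) * S
    ≡⟨ *-identityʳ _ ⟨
  fromℕ (card 𝓕) * S * 1ℚ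
    ≡⟨ cong (fromℕ (card 𝓕) * S *_) (fromℕ*1÷ℕ (n C k) {{ℕ.>-nonZero (k≤n⇒nCk>0 k≤n)}}) ⟨
  fromℕ (card 𝓕) * S * (fromℕ (n C k) * (1 ÷ℕ (n C k)))
    ≡⟨ regroup (fromℕ (card 𝓕)) S (fromℕ (n C k)) (1 ÷ℕ (n C k)) ⟩
  (fromℕ (n C k) * S) * (fromℕ (card 𝓕) * (1 ÷ℕ (n C k)))
    ≡⟨ cong₂ _*_ (upperTail≡nCk*singletonMass q n k) (÷ℕ≡fromℕ*1÷ℕ (card 𝓕) (n C k)) ⟨
  upperTail q n k * μ k 𝓕
    ∎
  where
  open ≡-Reasoning
  S : ℚ
  S = singletonMass q n k
  regroup : ∀ c s b r → c * s * (b * r) ≡ (b * s) * (c * r)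
  regroup = solve-∀ ℚ-ring

-- The tail estimate

k÷ℕn+ε≤q⇒k+nε≤nq : ∀ {q n k ε} .{{_ : NonZero n}} →
  k ÷ℕ n + ε ≤ q → fromℕ k + fromℕ n * ε ≤ fromℕ n * q
k÷ℕn+ε≤q⇒k+nε≤nq {q} {n} {k} {ε} k/n+ε≤q = subst (_≤ fromℕ n * q)
  (trans (*-distribˡ-+ (fromℕ n) (k ÷ℕ n) ε) (cong (_+ fromℕ n * ε) (fromℕ*÷ℕ k n)))
  (*-monoˡ-≤-0≤ (0≤fromℕ n) k/n+ε≤q)

lowerTail*nε²≤1 : ∀ {q n k ε} .{{_ : NonZero n}} → 0ℚ ≤ q → q ≤ 1ℚ → 0ℚ ≤ ε →
  fromℕ k + fromℕ n * ε ≤ fromℕ n * q → (1ℚ - upperTail q n k) * (fromℕ n * (ε * ε)) ≤ 1ℚ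
lowerTail*nε²≤1 {q} {n} {k} {ε} 0≤q q≤1 0≤ε k+nε≤nq =
  *-cancelˡ-≤-pos N {{positive (0<fromℕ n)}} (begin
    N * (Q * (N * (ε * ε)))   ≡⟨ spread N Q ε ⟩
    Q * (N * ε * (N * ε))     ≤⟨ chebyshev-lowerTail {q} {n} {k} 0≤q q≤1 (0≤* (0≤fromℕ n) 0≤ε) k+nε≤nq ⟩
    N * q * (1ℚ - q)          ≡⟨ *-assoc N q (1ℚ - q) ⟩
    N * (q * (1ℚ - q))        ≤⟨ *-monoˡ-≤-0≤ (0≤fromℕ n) (q*[1-q]≤1 0≤q q≤1) ⟩
    N * 1ℚ                    ∎)
  where
  open ≤-Reasoning
  N Q : ℚ
  N = fromℕ n
  Q = 1ℚ - upperTail q n k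
  spread : ∀ n q e → n * (q * (n * (e * e))) ≡ q * (n * e * (n * e))
  spread = solve-∀ ℚ-ring

-- n ε³ ≥ 2 turns the Chebyshev bound μ_q(|x| < k) ≤ 1/(n ε²) into μ_q(|x| < k) ≤ ε/(1 + ε).
1≤upperTail*[1+ε] : ∀ {q n k ε} .{{_ : NonZero n}} → 0ℚ < q → q < 1ℚ → 0ℚ < ε →
  1ℚ + 1ℚ ≤ fromℕ n * (ε * ε * ε) → k ÷ℕ n + ε ≤ q → 1ℚ ≤ upperTail q n k * (1ℚ + ε)
1≤upperTail*[1+ε] {q} {n} {k} {ε} 0<q q<1 0<ε 2≤nε³ k/n+ε≤q = begin
  1ℚ                       ≡⟨ cancel ε ⟩
  (1ℚ + ε) - ε             ≤⟨ +-monoʳ-≤ (1ℚ + ε) (neg-antimono-≤ Q[1+ε]≤ε) ⟩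
  (1ℚ + ε) - Q * (1ℚ + ε)  ≡⟨ complement P ε ⟩
  P * (1ℚ + ε)             ∎
  where
  open ≤-Reasoning
  cancel : ∀ e → 1ℚ ≡ (1ℚ + e) - e
  cancel = solve-∀ ℚ-ring
  complement : ∀ p e → (1ℚ + e) - (1ℚ - p) * (1ℚ + e) ≡ p * (1ℚ + e)
  complement = solve-∀ ℚ-ring
  extract : ∀ q n e → q * (n * (e * e * e)) ≡ e * (q * (n * (e * e)))
  extract = solve-∀ ℚ-ring
  P Q : ℚ
  P = upperTail q n k
  Q = 1ℚ - P
  0≤q : 0ℚ ≤ q
  0≤q = <⇒≤ 0<q
  0≤ε : 0ℚ ≤ ε
  0≤ε = <⇒≤ 0<ε
  ε≤1 : ε ≤ 1ℚ
  ε≤1 = ≤-trans (subst (_≤ k ÷ℕ n + ε) (+-identityˡ ε) (+-monoˡ-≤ ε (0≤÷ℕ k n)))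
                (≤-trans k/n+ε≤q (<⇒≤ q<1))
  0≤Q : 0ℚ ≤ Q
  0≤Q = p≤q⇒0≤q-p (upperTail≤1 {q} {n} {k} 0≤q (<⇒≤ q<1))
  Qnε²≤1 : Q * (fromℕ n * (ε * ε)) ≤ 1ℚ
  Qnε²≤1 = lowerTail*nε²≤1 {q} {n} {k} 0≤q (<⇒≤ q<1) 0≤ε (k÷ℕn+ε≤q⇒k+nε≤nq k/n+ε≤q)
  Q[1+ε]≤ε : Q * (1ℚ + ε) ≤ ε
  Q[1+ε]≤ε = begin
    Q * (1ℚ + ε)                    ≤⟨ *-monoˡ-≤-0≤ 0≤Q (+-monoʳ-≤ 1ℚ ε≤1) ⟩
    Q * (1ℚ + 1ℚ)                   ≤⟨ *-monoˡ-≤-0≤ 0≤Q 2≤nε³ ⟩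
    Q * (fromℕ n * (ε * ε * ε))     ≡⟨ extract Q (fromℕ n) ε ⟩
    ε * (Q * (fromℕ n * (ε * ε)))   ≤⟨ *-monoˡ-≤-0≤ 0≤ε Qnε²≤1 ⟩
    ε * 1ℚ                          ≡⟨ *-identityʳ ε ⟩
    ε                               ∎

-- ε ≥ 1/b for the denominator b of ε, so n₀ = 2b³ will do.
eventually-2≤nε³ : ∀ ε → 0ℚ < ε → Σ ℕ λ n₀ → ∀ n → n₀ ℕ.< n → 1ℚ + 1ℚ ≤ fromℕ n * (ε * ε * ε)
eventually-2≤nε³ ε@(mkℚ (ℤ.+ suc a) b-1 _) _ = n₀ , λ n n₀<n → begin
  1ℚ + 1ℚ                        ≡⟨ n₀b⁻³≡2 ⟨
  fromℕ n₀ * (b⁻¹ * b⁻¹ * b⁻¹)   ≤⟨ *-monoʳ-≤-0≤ (0≤* (0≤p*p b⁻¹) (0≤1÷ℕ b)) (fromℕ-mono-≤ (ℕ.<⇒≤ n₀<n)) ⟩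
  fromℕ n * (b⁻¹ * b⁻¹ * b⁻¹)    ≤⟨ *-monoˡ-≤-0≤ (0≤fromℕ n) (cube-mono-≤ (0≤1÷ℕ b) b⁻¹≤ε) ⟩
  fromℕ n * (ε * ε * ε)          ∎
  where
  open ≤-Reasoning
  b n₀ : ℕ
  b  = suc b-1
  n₀ = 2 ℕ.* (b ℕ.* b ℕ.* b)
  b⁻¹ : ℚ
  b⁻¹ = 1 ÷ℕ b
  b⁻¹≤ε : b⁻¹ ≤ ε
  b⁻¹≤ε = begin
    b⁻¹                   ≡⟨ *-identityˡ b⁻¹ ⟨
    1ℚ * b⁻¹              ≤⟨ *-monoʳ-≤-0≤ (0≤1÷ℕ b) (fromℕ-mono-≤ {m = 1} {n = suc a} (ℕ.s≤s ℕ.z≤n)) ⟩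
    fromℕ (suc a) * b⁻¹   ≡⟨ ÷ℕ≡fromℕ*1÷ℕ (suc a) b ⟨
    suc a ÷ℕ b            ≡⟨ ↥p/↧p≡p ε ⟩
    ε                     ∎
  regroup : ∀ d r → (1ℚ + 1ℚ) * (d * d * d) * (r * r * r) ≡ (1ℚ + 1ℚ) * ((d * r) * (d * r) * (d * r))
  regroup = solve-∀ ℚ-ring
  n₀b⁻³≡2 : fromℕ n₀ * (b⁻¹ * b⁻¹ * b⁻¹) ≡ 1ℚ + 1ℚ
  n₀b⁻³≡2 = begin-equality
    fromℕ n₀ * (b⁻¹ * b⁻¹ * b⁻¹)
      ≡⟨ cong (_* (b⁻¹ * b⁻¹ * b⁻¹)) (trans (fromℕ-* 2 (b ℕ.* b ℕ.* b))
           (cong (fromℕ 2 *_) (trans (fromℕ-* (b ℕ.* b) b) (cong (_* fromℕ b) (fromℕ-* b b))))) ⟩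
    (1ℚ + 1ℚ) * (fromℕ b * fromℕ b * fromℕ b) * (b⁻¹ * b⁻¹ * b⁻¹)
      ≡⟨ regroup (fromℕ b) b⁻¹ ⟩
    (1ℚ + 1ℚ) * ((fromℕ b * b⁻¹) * (fromℕ b * b⁻¹) * (fromℕ b * b⁻¹))
      ≡⟨ cong (λ t → (1ℚ + 1ℚ) * (t * t * t)) (fromℕ*1÷ℕ b) ⟩
    1ℚ + 1ℚ
      ∎
eventually-2≤nε³ (mkℚ (ℤ.+ 0) _ _)    (*<* (ℤ.+<+ ()))
eventually-2≤nε³ (mkℚ ℤ.-[1+ _ ] _ _) (*<* ())

p*x≤x≤p*x*[1+ε] : ∀ {x} → 0ℚ ≤ x → p ≤ 1ℚ → 1ℚ ≤ p * (1ℚ + ε) →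
  (p * x ≤ x) × (x ≤ p * x * (1ℚ + ε))
p*x≤x≤p*x*[1+ε] {p} {ε} {x} 0≤x p≤1 1≤p[1+ε] =
  ( (begin
      p * x                   ≤⟨ *-monoʳ-≤-0≤ 0≤x p≤1 ⟩
      1ℚ * x                  ≡⟨ *-identityˡ x ⟩
      x                       ∎)
  , (begin
      x                       ≡⟨ *-identityˡ x ⟨
      1ℚ * x                  ≤⟨ *-monoʳ-≤-0≤ 0≤x 1≤p[1+ε] ⟩
      p * (1ℚ + ε) * x        ≡⟨ swap p (1ℚ + ε) x ⟩
      p * x * (1ℚ + ε)        ∎))
  where
  open ≤-Reasoning
  swap : ∀ a b c → a * b * c ≡ a * c * b
  swap = solve-∀ ℚ-ring

lemma6p6 : (ε : ℚ) → 0ℚ < ε →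
    Σ ℕ λ n₀ → (n k : ℕ) → n₀ ℕ.< n → k ℕ.≤ n →
      (q : ℚ) → 0ℚ < q → q < 1ℚ → (k ÷ℕ n) + ε ≤ q →
      (𝓕 : Family n) → IsUniform k 𝓕 →
      (μ[ q ] (f[ 𝓕 ] k) ≤ μ k 𝓕) × (μ k 𝓕 ≤ μ[ q ] (f[ 𝓕 ] k) * (1ℚ + ε))
lemma6p6 ε 0<ε =
  let n₀ , 2≤nε³ = eventually-2≤nε³ ε 0<ε in
  n₀ , λ n k n₀<n k≤n q 0<q q<1 k/n+ε≤q 𝓕 uniform →
    let instance
          n≢0 : NonZero n
          n≢0 = ℕ.>-nonZero (ℕ.m<n⇒0<n n₀<n)
    in subst (λ t → (t ≤ μ k 𝓕) × (μ k 𝓕 ≤ t * (1ℚ + ε)))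
             (sym (μ-f≡upperTail*μ k≤n uniform))
             (p*x≤x≤p*x*[1+ε] {ε = ε} (0≤÷ℕ (card 𝓕) (n C k))
               (upperTail≤1 {q} {n} {k} (<⇒≤ 0<q) (<⇒≤ q<1))
               (1≤upperTail*[1+ε] 0<q q<1 0<ε (2≤nε³ n n₀<n) k/n+ε≤q))
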